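{- Let $m,n\in\mathbb{N}_0$, let $\Lambda_{m,n}:=\{0,1,\dots,m\}\times\{0,1,\dots,n\}$, and let $h:\Lambda_{m,n}\to\mathbb{C}$ be a function such that $h(i,0)\neq0$ for $i\in\{0,1,\dots,m-1\}$ and $h(0,j)\neq1$ for $j\in\{0,1,\dots,n-1\}$. Let $(B(k,\ell))_{(k,\ell)\in\Lambda_{m,n}}$ be the unique family determined by $B(k,0)=1$ for $k\in\{0,\dots,m\}$, $B(0,\ell)=1$ for $\ell\in\{0,\dots,n\}$, and $$B(k,\ell)=\frac{h(k-1,\ell)}{h(k-1,0)}B(k-1,\ell)+\frac{1-h(k,\ell-1)}{1-h(0,\ell-1)}B(k,\ell-1)$$ for $k\in\{1,\dots,m\}$, $\ell\in\{1,\dots,n\}$. Define $A(0,0):=1$, $A(k,0):=\prod_{i=0}^{k-1}h(i,0)$ for $k\in\{1,\dots,m\}$, $A(0,\ell):=\prod_{j=0}^{\ell-1}(1-h(0,j))$ for $\ell\in\{1,\dots,n\}$, and $A(k,\ell):=A(k,0)A(0,\ell)B(k,\ell)$ for $k\in\{1,\dots,m\}$, $\ell\in\{1,\dots,n\}$. Then $$1=\sum_{k=0}^m(1-h(k,n))A(k,n)+\sum_{\ell=0}^n h(m,\ell)A(m,\ell).$$ -}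

module Defs where

open import Level using (Level; _⊔_) renaming (suc to lsuc)
open import Data.Nat using (ℕ; zero; suc)
open import Algebra.Bundles using (CommutativeRing)
open import Relation.Nullary using (¬_)

record Field (c ℓ : Level) : Set (lsuc (c ⊔ ℓ)) where
  field
    commutativeRing : CommutativeRing c ℓ
  open CommutativeRing commutativeRing public
  field
    0≉1      : ¬ (0# ≈ 1#)
    _⁻¹      : Carrier → Carrier
    ⁻¹-inverseʳ : ∀ x → ¬ (x ≈ 0#) → x * (x ⁻¹) ≈ 1#

module FieldDefs {c ℓ} (F : Field c ℓ) where
  open Field F hiding (zero)

  prodBelow : (ℕ → Carrier) → ℕ → Carrier
  prodBelow f zero    = 1#
  prodBelow f (suc k) = prodBelow f k * f k

  sumUpTo : (ℕ → Carrier) → ℕ → Carrier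
  sumUpTo f zero    = f zero
  sumUpTo f (suc m) = sumUpTo f m + f (suc m)

  module _ (h : ℕ → ℕ → Carrier) where

    B : ℕ → ℕ → Carrier
    B zero    l       = 1#
    B (suc k) zero    = 1#
    B (suc k) (suc l) =
        (h k (suc l) * (h k zero ⁻¹)) * B k (suc l)
      + ((1# - h (suc k) l) * ((1# - h zero l) ⁻¹)) * B (suc k) l

    A : ℕ → ℕ → Carrier
    A zero    zero    = 1#
    A (suc k) zero    = prodBelow (λ i → h i zero) (suc k)
    A zero    (suc l) = prodBelow (λ j → 1# - h zero j) (suc l)
    A (suc k) (suc l) = A (suc k) zero * A zero (suc l) * B (suc k) (suc l)

{-# OPTIONS --safe #-}
-- Read h k l as the probability that a walker at (k, l) steps to (k+1, l), and
-- 1 - h k l as the probability that it steps to (k, l+1).  Whatever the weights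
-- B, the family A satisfies exactly the inflow equations of this walk: the mass
-- at a site is what flows into it from its left and lower neighbours (the
-- normalisations by h k 0 and 1 - h 0 l are what make the weights of B cancel).
-- Mass is therefore conserved row by row, so the unit mass started at the
-- origin leaves the rectangle completely, through its top row or right column.
module Submission where

open import Defs
open import Data.Nat using (ℕ; zero; suc; _<_; _≤_)
open import Data.Nat.Properties using (<⇒≤; ≤-refl)
open import Relation.Nullary using (¬_)
import Algebra.Properties.Group as GroupProperties
import Algebra.Solver.CommutativeMonoid as CommutativeMonoidSolver
import Relation.Binary.Reasoning.Setoid as SetoidReasoning

module _ {c ℓ} (F : Field c ℓ) where
  open Field F hiding (zero)
  open FieldDefs F
  open GroupProperties +-group using (//-rightDividesˡ; x∙y⁻¹≈ε⇒x≈y)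
  open SetoidReasoning setoid
  module +-Solver = CommutativeMonoidSolver +-commutativeMonoid
  module *-Solver = CommutativeMonoidSolver *-commutativeMonoid

  1-x+x≈1 : ∀ x → (1# - x) + x ≈ 1#
  1-x+x≈1 x = //-rightDividesˡ x 1#

  split-by : ∀ x y → y ≈ (1# - x) * y + x * y
  split-by x y = begin
    y                       ≈⟨ *-identityˡ y ⟨
    1# * y                  ≈⟨ *-congʳ (1-x+x≈1 x) ⟨
    ((1# - x) + x) * y      ≈⟨ distribʳ y (1# - x) x ⟩
    (1# - x) * y + x * y    ∎

  x≉1⇒1-x≉0 : ∀ {x} → ¬ (x ≈ 1#) → ¬ (1# - x ≈ 0#)
  x≉1⇒1-x≉0 x≉1 1-x≈0 = x≉1 (sym (x∙y⁻¹≈ε⇒x≈y 1# _ 1-x≈0))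

  -- Mass balance along one row: r k is the mass at site k, h k the probability
  -- of passing it on to site k+1, and g k the mass arriving from outside.
  row-balance : (h r g : ℕ → Carrier) (m : ℕ) →
    r 0 ≈ g 0 →
    (∀ k → k < m → r (suc k) ≈ h k * r k + g (suc k)) →
    ∀ j → j ≤ m → sumUpTo g j ≈ sumUpTo (λ k → (1# - h k) * r k) j + h j * r j
  row-balance h r g m r₀ inflow zero    _   = trans (sym r₀) (split-by (h 0) (r 0))
  row-balance h r g m r₀ inflow (suc j) j<m = begin
    sumUpTo g j + g (suc j)
      ≈⟨ +-congʳ (row-balance h r g m r₀ inflow j (<⇒≤ j<m)) ⟩
    (S + h j * r j) + g (suc j)
      ≈⟨ +-assoc S _ _ ⟩
    S + (h j * r j + g (suc j))
      ≈⟨ +-congˡ (sym (inflow j j<m)) ⟩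
    S + r (suc j)
      ≈⟨ +-congˡ (split-by (h (suc j)) (r (suc j))) ⟩
    S + ((1# - h (suc j)) * r (suc j) + h (suc j) * r (suc j))
      ≈⟨ +-assoc S _ _ ⟨
    (S + (1# - h (suc j)) * r (suc j)) + h (suc j) * r (suc j) ∎
    where S = sumUpTo (λ k → (1# - h k) * r k) j

  flow-conservation : (m n : ℕ) (h a : ℕ → ℕ → Carrier) →
    (∀ k → k < m → a (suc k) 0 ≈ h k 0 * a k 0) →
    (∀ l → l < n → a 0 (suc l) ≈ (1# - h 0 l) * a 0 l) →
    (∀ k l → k < m → l < n →
       a (suc k) (suc l) ≈ h k (suc l) * a k (suc l) + (1# - h (suc k) l) * a (suc k) l) →
    a 0 0 ≈ sumUpTo (λ k → (1# - h k n) * a k n) m + sumUpTo (λ l → h m l * a m l) n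
  flow-conservation m n h a column₀ row₀ interior = conserved n ≤-refl
    where
    up : ℕ → Carrier
    up l = sumUpTo (λ k → (1# - h k l) * a k l) m

    right : ℕ → Carrier
    right = sumUpTo (λ l → h m l * a m l)

    source : ℕ → Carrier
    source zero    = a 0 0
    source (suc _) = 0#

    sumUpTo-source : ∀ j → sumUpTo source j ≈ a 0 0
    sumUpTo-source zero    = refl
    sumUpTo-source (suc j) = trans (+-identityʳ _) (sumUpTo-source j)

    bottom-row : a 0 0 ≈ up 0 + h m 0 * a m 0
    bottom-row = trans (sym (sumUpTo-source m))
      (row-balance (λ k → h k 0) (λ k → a k 0) source m refl
        (λ k k<m → trans (column₀ k k<m) (sym (+-identityʳ _))) m ≤-refl)

    next-row : ∀ l → l < n → up l ≈ up (suc l) + h m (suc l) * a m (suc l)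
    next-row l l<n = row-balance (λ k → h k (suc l)) (λ k → a k (suc l))
      (λ k → (1# - h k l) * a k l) m (row₀ l l<n)
      (λ k k<m → interior k l k<m l<n) m ≤-refl

    conserved : ∀ l → l ≤ n → a 0 0 ≈ up l + right l
    conserved zero    _   = bottom-row
    conserved (suc l) l<n = begin
      a 0 0                                ≈⟨ conserved l (<⇒≤ l<n) ⟩
      up l + right l                       ≈⟨ +-congʳ (next-row l l<n) ⟩
      (up (suc l) + x) + right l           ≈⟨ solve 3 (λ u x r → (u ⊕ x) ⊕ r ⊜ u ⊕ (r ⊕ x))
                                                refl (up (suc l)) x (right l) ⟩
      up (suc l) + (right l + x)           ∎
      where
      open +-Solver using (solve; _⊕_; _⊜_)
      x = h m (suc l) * a m (suc l)

  module _ (h : ℕ → ℕ → Carrier) where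
    P Q : ℕ → Carrier
    P = prodBelow (λ i → h i 0)
    Q = prodBelow (λ j → 1# - h 0 j)

    A≈P*Q*B : ∀ k l → A h k l ≈ P k * Q l * B h k l
    A≈P*Q*B zero    zero    = sym (trans (*-identityʳ _) (*-identityʳ _))
    A≈P*Q*B zero    (suc l) = sym (trans (*-identityʳ _) (*-identityˡ _))
    A≈P*Q*B (suc k) zero    = sym (trans (*-identityʳ _) (*-identityʳ _))
    A≈P*Q*B (suc k) (suc l) = refl

    A-column₀ : ∀ k → A h (suc k) 0 ≈ h k 0 * A h k 0
    A-column₀ zero    = *-comm 1# (h 0 0)
    A-column₀ (suc k) = *-comm _ _

    A-row₀ : ∀ l → A h 0 (suc l) ≈ (1# - h 0 l) * A h 0 l
    A-row₀ zero    = *-comm 1# _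
    A-row₀ (suc l) = *-comm _ _

    cancel-⁻¹ : ∀ {x} → ¬ (x ≈ 0#) → ∀ p u b → (p * x) * ((u * x ⁻¹) * b) ≈ u * (p * b)
    cancel-⁻¹ {x} x≉0 p u b = begin
      (p * x) * ((u * x ⁻¹) * b)  ≈⟨ solve 5 (λ p x u y b → (p ⊕ x) ⊕ ((u ⊕ y) ⊕ b) ⊜ (u ⊕ (p ⊕ b)) ⊕ (x ⊕ y))
                                       refl p x u (x ⁻¹) b ⟩
      u * (p * b) * (x * x ⁻¹)    ≈⟨ *-congˡ (⁻¹-inverseʳ x x≉0) ⟩
      u * (p * b) * 1#            ≈⟨ *-identityʳ _ ⟩
      u * (p * b)                 ∎
      where open *-Solver using (solve; _⊕_; _⊜_)

    A-interior : ∀ k l → ¬ (h k 0 ≈ 0#) → ¬ (1# - h 0 l ≈ 0#) →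
      A h (suc k) (suc l) ≈ h k (suc l) * A h k (suc l) + (1# - h (suc k) l) * A h (suc k) l
    A-interior k l hk₀≉0 1-h₀l≉0 = begin
      (P k * hk₀) * Q (suc l) * ((u * hk₀ ⁻¹) * B h k (suc l) + (v * d ⁻¹) * B h (suc k) l)
        ≈⟨ distribˡ _ _ _ ⟩
      (P k * hk₀) * Q (suc l) * ((u * hk₀ ⁻¹) * B h k (suc l))
        + P (suc k) * (Q l * d) * ((v * d ⁻¹) * B h (suc k) l)
        ≈⟨ +-cong (*-congʳ (solve 3 (λ p x q → (p ⊕ x) ⊕ q ⊜ (p ⊕ q) ⊕ x) refl (P k) hk₀ (Q (suc l))))
                  (*-congʳ (sym (*-assoc (P (suc k)) (Q l) d))) ⟩
      (P k * Q (suc l) * hk₀) * ((u * hk₀ ⁻¹) * B h k (suc l))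
        + (P (suc k) * Q l * d) * ((v * d ⁻¹) * B h (suc k) l)
        ≈⟨ +-cong (cancel-⁻¹ hk₀≉0 _ u _) (cancel-⁻¹ 1-h₀l≉0 _ v _) ⟩
      u * (P k * Q (suc l) * B h k (suc l)) + v * (P (suc k) * Q l * B h (suc k) l)
        ≈⟨ +-cong (*-congˡ (A≈P*Q*B k (suc l))) (*-congˡ (A≈P*Q*B (suc k) l)) ⟨
      u * A h k (suc l) + v * A h (suc k) l ∎
      where
      open *-Solver using (solve; _⊕_; _⊜_)
      hk₀ = h k 0
      d   = 1# - h 0 l
      u   = h k (suc l)
      v   = 1# - h (suc k) l

proposition2p1 : ∀ {c ℓ} (F : Field c ℓ) → let open Field F in let open FieldDefs F in
    (m n : ℕ) (h : ℕ → ℕ → Carrier) →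
    (∀ i → i < m → ¬ (h i 0 ≈ 0#)) →
    (∀ j → j < n → ¬ (h 0 j ≈ 1#)) →
    1# ≈ sumUpTo (λ k → (1# - h k n) * A h k n) m + sumUpTo (λ l → h m l * A h m l) n
proposition2p1 F m n h h₀≉0 h₀≉1 =
  flow-conservation F m n h (A h) (λ k _ → A-column₀ F h k) (λ l _ → A-row₀ F h l)
    (λ k l k<m l<n → A-interior F h k l (h₀≉0 k k<m) (x≉1⇒1-x≉0 F (h₀≉1 l l<n)))
  where open FieldDefs F
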